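{- Let $n\ge 3$ and let $L\cong\mathbf{2}^n$ be a Boolean lattice. Then $\operatorname{sdim}_M(G^c(L))=2^n-2^{n-1}-1$.
   Context: For a lattice $M$ with $0$: $Z^*(M)$ is the set of nonzero $a$ with $a\wedge b=0$ for some $b\ne0$; $G^c(M)$ is the graph on $Z^*(M)$ with distinct $a,b$ adjacent iff $a\wedge b\neq 0$. In a connected graph $G$, a vertex $w$ strongly resolves $u,v$ if some shortest $u$–$w$ path contains $v$ or some shortest $v$–$w$ path contains $u$; $W\subseteq V(G)$ is a strong resolving set if every pair of distinct vertices is strongly resolved by some vertex in $W$; $\operatorname{sdim}_M(G)$ is the minimum size of a strong resolving set. -}

module Defs where

open import Data.Nat using (ℕ; zero; suc; _≤_)
open import Data.Product using (Σ; ∃; _×_; _,_)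
open import Data.Sum using (_⊎_)
open import Data.List using (List; length)
open import Data.List.Membership.Propositional using (_∈_)
open import Data.List.Relation.Unary.All using (All)
open import Data.List.Relation.Unary.Unique.Propositional using (Unique)
open import Relation.Binary.PropositionalEquality using (_≡_; _≢_)
import Data.Fin.Subset as FS

record Graph (A : Set) : Set₁ where
  field
    Vert : A → Set
    Adj  : A → A → Set

module _ {A : Set} (G : Graph A) where
  open Graph G

  data Walk (u : A) : A → ℕ → Set where
    here : Vert u → Walk u u 0
    step : ∀ {v w k} → Walk u v k → Adj v w → Vert w → Walk u w (suc k)

  OnWalk : ∀ {u w k} → A → Walk u w k → Set
  OnWalk {u} x (here _) = x ≡ u
  OnWalk {w = w} x (step p _ _) = x ≡ w ⊎ OnWalk x p

  IsShortest : ∀ {u w k} → Walk u w k → Set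
  IsShortest {u} {w} {k} _ = ∀ k' → Walk u w k' → k ≤ k'

  ShortestVia : A → A → A → Set
  ShortestVia u w v = Σ ℕ λ k → Σ (Walk u w k) λ p → IsShortest p × OnWalk v p

  StronglyResolves : A → A → A → Set
  StronglyResolves w u v = ShortestVia u w v ⊎ ShortestVia v w u

  IsStrongResolvingSet : List A → Set
  IsStrongResolvingSet W =
    All Vert W ×
    (∀ u v → Vert u → Vert v → u ≢ v →
       ∃ λ w → w ∈ W × StronglyResolves w u v)

  IsSdim : ℕ → Set
  IsSdim m =
    (Σ (List A) λ W → Unique W × IsStrongResolvingSet W × length W ≡ m) ×
    (∀ W → IsStrongResolvingSet W → m ≤ length W)

module _ {A : Set} (_∧_ : A → A → A) (𝟘 : A) where

  Zstar : A → Set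
  Zstar a = a ≢ 𝟘 × ∃ λ b → b ≢ 𝟘 × (a ∧ b) ≡ 𝟘

  Gc : Graph A
  Gc = record
    { Vert = Zstar
    ; Adj  = λ a b → a ≢ b × (a ∧ b) ≢ 𝟘
    }

-- The Boolean lattice 2ⁿ, realised as the subsets of an n-element set
-- (meet = intersection, 0 = empty set).

BoolLat : ℕ → Set
BoolLat n = FS.Subset n

GcBool : (n : ℕ) → Graph (BoolLat n)
GcBool n = Gc (FS._∩_ {n}) (FS.⊥ {n})

{-# OPTIONS --safe #-}
module Submission where

-- The vertices of G^c(2ⁿ) are the nonempty proper subsets of {0, …, n-1}, adjacent when
-- they meet.  For n ≥ 3 the graph has diameter at most 2: disjoint u and w are joined
-- through ∁ {z}, where z differs from a point of u and a point of w.  A subset p and its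
-- complement are at distance 2, so in a graph of diameter 2 the only vertices strongly
-- resolving them are p and ∁ p themselves; hence a strong resolving set meets each of the
-- 2ⁿ⁻¹ - 1 complementary pairs.  Conversely the 2ⁿ⁻¹ - 1 vertices avoiding 0 form a strong
-- resolving set: a pair containing such a vertex is resolved by it, and of two sets
-- containing 0 that differ at x, the one containing x lies on a shortest path from the
-- other one to {x}.

open import Defs
open import Data.Nat using (ℕ; zero; suc; _+_; _^_; _∸_; _≤_; z≤n; s≤s)
open import Data.Nat.Properties
  using (≤-refl; ≤-trans; +-identityʳ; +-suc; +-mono-≤; +-monoˡ-≤; m+1+n≰m; m+n∸m≡n; ∸-monoˡ-≤; module ≤-Reasoning)
open import Data.Bool using (Bool; true; false)
import Data.Bool as Bool
open import Data.Fin using (Fin; zero; suc)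
open import Data.Vec using (Vec; []; _∷_; here; there)
open import Data.Vec.Properties using (≡-dec; ∷-injectiveʳ)
open import Data.Fin.Subset using (Subset; inside; outside; _∈_; _∉_; ⊥; ⁅_⁆; ∁; _∩_; Nonempty)
open import Data.Fin.Subset.Properties
  using (nonempty?; Empty-unique; ∉⊥; x∈p∩q⁺; x∈p∩q⁻; x∈⁅x⁆; x∈⁅y⁆⇒x≡y; x≢y⇒x∉⁅y⁆;
         x∉p⇒x∈∁p; x∈p⇒x∉∁p; x∈∁p⇒x∉p; drop-there; ∪-∩-booleanAlgebra)
import Algebra.Lattice.Properties.BooleanAlgebra as BooleanAlgebraProperties
open import Data.Product using (∃; ∃₂; _×_; _,_)
open import Data.Sum using (_⊎_; inj₁; inj₂)
open import Data.List using (List; []; _∷_; map; _++_; length)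
open import Data.List.Properties using (length-map; length-++)
open import Data.List.Membership.Propositional renaming (_∈_ to _∈ˡ_) using ()
open import Data.List.Membership.Propositional.Properties using (∈-map⁺; ∈-map⁻; ∈-++⁺ˡ; ∈-++⁺ʳ)
open import Data.List.Relation.Unary.Any using (here; there)
open import Data.List.Relation.Unary.All as All using (All)
import Data.List.Relation.Unary.All.Properties as All
import Data.List.Relation.Unary.AllPairs as AllPairs
open import Data.List.Relation.Unary.Unique.Propositional using (Unique)
import Data.List.Relation.Unary.Unique.Propositional.Properties as Unique
open import Data.List.Relation.Binary.Disjoint.Propositional using (Disjoint)
open import Function using (_∘_)
open import Relation.Binary.PropositionalEquality using (_≡_; _≢_; refl; sym; trans; cong; cong₂; subst)
open import Relation.Nullary using (Dec; yes; no; ¬_; contradiction)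
open import Relation.Nullary.Decidable using (¬?; _×-dec_; decidable-stable)

module _ {m : ℕ} where

  tailsWithHead : Bool → List (Vec Bool (suc m)) → List (Vec Bool m)
  tailsWithHead _     []                 = []
  tailsWithHead true  ((true  ∷ v) ∷ vs) = v ∷ tailsWithHead true vs
  tailsWithHead false ((false ∷ v) ∷ vs) = v ∷ tailsWithHead false vs
  tailsWithHead b     (_ ∷ vs)           = tailsWithHead b vs

  ∈-tailsWithHead : ∀ {b v vs} → (b ∷ v) ∈ˡ vs → v ∈ˡ tailsWithHead b vs
  ∈-tailsWithHead {true}  (here refl) = here refl
  ∈-tailsWithHead {false} (here refl) = here refl
  ∈-tailsWithHead {true}  {vs = (true  ∷ _) ∷ _} (there v∈vs) = there (∈-tailsWithHead v∈vs)
  ∈-tailsWithHead {true}  {vs = (false ∷ _) ∷ _} (there v∈vs) = ∈-tailsWithHead v∈vs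
  ∈-tailsWithHead {false} {vs = (true  ∷ _) ∷ _} (there v∈vs) = ∈-tailsWithHead v∈vs
  ∈-tailsWithHead {false} {vs = (false ∷ _) ∷ _} (there v∈vs) = there (∈-tailsWithHead v∈vs)

  length-tailsWithHead : ∀ vs →
    length (tailsWithHead true vs) + length (tailsWithHead false vs) ≡ length vs
  length-tailsWithHead []                 = refl
  length-tailsWithHead ((true  ∷ _) ∷ vs) = cong suc (length-tailsWithHead vs)
  length-tailsWithHead ((false ∷ _) ∷ vs) =
    trans (+-suc _ _) (cong suc (length-tailsWithHead vs))

complete⇒2^m≤length : ∀ m (vs : List (Vec Bool m)) → (∀ v → v ∈ˡ vs) → 2 ^ m ≤ length vs
complete⇒2^m≤length zero    []      complete = contradiction (complete []) λ ()
complete⇒2^m≤length zero    (_ ∷ _) _        = s≤s z≤n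
complete⇒2^m≤length (suc m) vs      complete = begin
  2 ^ m + (2 ^ m + 0)                                              ≡⟨ cong (2 ^ m +_) (+-identityʳ (2 ^ m)) ⟩
  2 ^ m + 2 ^ m                                                    ≤⟨ +-mono-≤ (half true) (half false) ⟩
  length (tailsWithHead true vs) + length (tailsWithHead false vs) ≡⟨ length-tailsWithHead vs ⟩
  length vs                                                        ∎
  where
  open ≤-Reasoning
  half : ∀ b → 2 ^ m ≤ length (tailsWithHead b vs)
  half b = complete⇒2^m≤length m (tailsWithHead b vs) (λ v → ∈-tailsWithHead (complete (b ∷ v)))

byHead : ∀ {m} → List (Subset m) → List (Subset m) → List (Subset (suc m))
byHead ps qs = map (outside ∷_) ps ++ map (inside ∷_) qs

byHead-unique : ∀ {m} {ps qs : List (Subset m)} → Unique ps → Unique qs → Unique (byHead ps qs)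
byHead-unique {ps = ps} {qs} ps! qs! =
  Unique.++⁺ (Unique.map⁺ ∷-injectiveʳ ps!) (Unique.map⁺ ∷-injectiveʳ qs!) heads-differ
  where
  heads-differ : Disjoint (map (outside ∷_) ps) (map (inside ∷_) qs)
  heads-differ (∈outside , ∈inside) with ∈-map⁻ (outside ∷_) ∈outside | ∈-map⁻ (inside ∷_) ∈inside
  ... | _ , _ , refl | _ , _ , ()

length-byHead : ∀ {m} (ps qs : List (Subset m)) → length (byHead ps qs) ≡ length ps + length qs
length-byHead ps qs =
  trans (length-++ (map (outside ∷_) ps))
        (cong₂ _+_ (length-map (outside ∷_) ps) (length-map (inside ∷_) qs))

subsets : ∀ m → List (Subset m)
subsets zero    = [] ∷ []
subsets (suc m) = byHead (subsets m) (subsets m)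

nonemptySubsets : ∀ m → List (Subset m)
nonemptySubsets zero    = []
nonemptySubsets (suc m) = byHead (nonemptySubsets m) (subsets m)

∈-subsets : ∀ {m} (s : Subset m) → s ∈ˡ subsets m
∈-subsets []            = here refl
∈-subsets (outside ∷ s) = ∈-++⁺ˡ (∈-map⁺ (outside ∷_) (∈-subsets s))
∈-subsets (inside  ∷ s) = ∈-++⁺ʳ _ (∈-map⁺ (inside ∷_) (∈-subsets s))

∈-nonemptySubsets : ∀ {m} {s : Subset m} {x} → x ∈ s → s ∈ˡ nonemptySubsets m
∈-nonemptySubsets {s = outside ∷ _} (there x∈s) = ∈-++⁺ˡ (∈-map⁺ (outside ∷_) (∈-nonemptySubsets x∈s))
∈-nonemptySubsets {s = inside  ∷ s} _           = ∈-++⁺ʳ _ (∈-map⁺ (inside ∷_) (∈-subsets s))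

nonemptySubsets-nonempty : ∀ m → All Nonempty (nonemptySubsets m)
nonemptySubsets-nonempty zero    = All.[]
nonemptySubsets-nonempty (suc m) = All.++⁺
  (All.map⁺ (All.map (λ (x , x∈s) → suc x , there x∈s) (nonemptySubsets-nonempty m)))
  (All.map⁺ (All.universal (λ _ → zero , here) (subsets m)))

subsets-unique : ∀ m → Unique (subsets m)
subsets-unique zero    = All.[] AllPairs.∷ AllPairs.[]
subsets-unique (suc m) = byHead-unique (subsets-unique m) (subsets-unique m)

nonemptySubsets-unique : ∀ m → Unique (nonemptySubsets m)
nonemptySubsets-unique zero    = AllPairs.[]
nonemptySubsets-unique (suc m) = byHead-unique (nonemptySubsets-unique m) (subsets-unique m)

length-subsets : ∀ m → length (subsets m) ≡ 2 ^ m
length-subsets zero    = refl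
length-subsets (suc m) = trans (length-byHead (subsets m) (subsets m))
  (cong₂ _+_ (length-subsets m) (trans (length-subsets m) (sym (+-identityʳ (2 ^ m)))))

length-nonemptySubsets : ∀ m → suc (length (nonemptySubsets m)) ≡ 2 ^ m
length-nonemptySubsets zero    = refl
length-nonemptySubsets (suc m) = trans (cong suc (length-byHead (nonemptySubsets m) (subsets m)))
  (cong₂ _+_ (length-nonemptySubsets m) (trans (length-subsets m) (sym (+-identityʳ (2 ^ m)))))

module _ {n : ℕ} where

  ∈⇒≢⊥ : ∀ {p : Subset n} {x} → x ∈ p → p ≢ ⊥
  ∈⇒≢⊥ x∈p refl = ∉⊥ x∈p

  ≢⊥⇒Nonempty : ∀ {p : Subset n} → p ≢ ⊥ → Nonempty p
  ≢⊥⇒Nonempty {p} p≢⊥ = decidable-stable (nonempty? p) (p≢⊥ ∘ Empty-unique)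

  disjoint⇒∩≡⊥ : ∀ {p q : Subset n} → (∀ {x} → x ∈ p → x ∉ q) → p ∩ q ≡ ⊥
  disjoint⇒∩≡⊥ {p} {q} disjoint =
    Empty-unique λ (x , x∈p∩q) → let x∈p , x∈q = x∈p∩q⁻ p q x∈p∩q in disjoint x∈p x∈q

  ∩≡⊥⇒disjoint : ∀ {p q : Subset n} {x} → p ∩ q ≡ ⊥ → x ∈ p → x ∉ q
  ∩≡⊥⇒disjoint p∩q≡⊥ x∈p x∈q = ∈⇒≢⊥ (x∈p∩q⁺ (x∈p , x∈q)) p∩q≡⊥

Distinguished : ∀ {m} → Subset m → Subset m → Set
Distinguished p q = ∃ λ x → x ∈ p × x ∉ q ⊎ x ∈ q × x ∉ p

distinguished-∷ : ∀ {m b c} {p q : Subset m} → Distinguished p q → Distinguished (b ∷ p) (c ∷ q)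
distinguished-∷ (x , inj₁ (x∈p , x∉q)) = suc x , inj₁ (there x∈p , x∉q ∘ drop-there)
distinguished-∷ (x , inj₂ (x∈q , x∉p)) = suc x , inj₂ (there x∈q , x∉p ∘ drop-there)

≢⇒distinguished : ∀ {m} (p q : Subset m) → p ≢ q → Distinguished p q
≢⇒distinguished []            []            p≢q = contradiction refl p≢q
≢⇒distinguished (inside  ∷ _) (outside ∷ _) _   = zero , inj₁ (here , λ ())
≢⇒distinguished (outside ∷ _) (inside  ∷ _) _   = zero , inj₂ (here , λ ())
≢⇒distinguished (inside  ∷ p) (inside  ∷ q) p≢q =
  distinguished-∷ (≢⇒distinguished p q (p≢q ∘ cong (inside ∷_)))
≢⇒distinguished (outside ∷ p) (outside ∷ q) p≢q =
  distinguished-∷ (≢⇒distinguished p q (p≢q ∘ cong (outside ∷_)))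

third-element : ∀ {n} → 3 ≤ n → (x y : Fin n) → ∃ λ z → z ≢ x × z ≢ y
third-element (s≤s (s≤s (s≤s _))) zero          zero          = suc zero , (λ ()) , (λ ())
third-element (s≤s (s≤s (s≤s _))) zero          (suc zero)    = suc (suc zero) , (λ ()) , (λ ())
third-element (s≤s (s≤s (s≤s _))) zero          (suc (suc _)) = suc zero , (λ ()) , (λ ())
third-element (s≤s (s≤s (s≤s _))) (suc zero)    zero          = suc (suc zero) , (λ ()) , (λ ())
third-element (s≤s (s≤s (s≤s _))) (suc (suc _)) zero          = suc zero , (λ ()) , (λ ())
third-element (s≤s (s≤s (s≤s _))) (suc _)       (suc _)       = zero , (λ ()) , (λ ())

module _ {A : Set} (G : Graph A) where
  open Graph G

  DistAtLeast : A → A → ℕ → Set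
  DistAtLeast u v d = ∀ k → Walk G u v k → d ≤ k

  Diameter≤2 : Set
  Diameter≤2 = ∀ {u w} → Vert u → Vert w → ∃ λ k → k ≤ 2 × Walk G u w k

  walk-length0 : ∀ {u w} → Walk G u w 0 → u ≡ w
  walk-length0 (here _) = refl

  walk-length1 : ∀ {u w} → Walk G u w 1 → Adj u w
  walk-length1 (step (here _) adj _) = adj

  distAtLeast-1 : ∀ {u v} → u ≢ v → DistAtLeast u v 1
  distAtLeast-1 u≢v zero    p = contradiction (walk-length0 p) u≢v
  distAtLeast-1 _   (suc _) _ = s≤s z≤n

  distAtLeast-2 : ∀ {u v} → u ≢ v → ¬ Adj u v → DistAtLeast u v 2
  distAtLeast-2 u≢v ¬adj zero          p = contradiction (walk-length0 p) u≢v
  distAtLeast-2 u≢v ¬adj (suc zero)    p = contradiction (walk-length1 p) ¬adj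
  distAtLeast-2 _   _    (suc (suc _)) _ = s≤s (s≤s z≤n)

  distant⇒≢ : ∀ {u v d} → Vert u → DistAtLeast u v (suc d) → u ≢ v
  distant⇒≢ u∈V far refl = contradiction (far 0 (here u∈V)) λ ()

  onWalk-target : ∀ {u w k} (p : Walk G u w k) → OnWalk G w p
  onWalk-target (here _)     = refl
  onWalk-target (step _ _ _) = inj₁ refl

  walk-splitAt : ∀ {u w k x} (p : Walk G u w k) → OnWalk G x p →
                 ∃₂ λ i j → Walk G u x i × Walk G x w j × i + j ≡ k
  walk-splitAt (here u∈V) refl = 0 , 0 , here u∈V , here u∈V , refl
  walk-splitAt {k = suc k} p@(step _ _ w∈V) (inj₁ refl) = suc k , 0 , p , here w∈V , +-identityʳ (suc k)
  walk-splitAt (step p adj w∈V) (inj₂ x∈p) with walk-splitAt p x∈p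
  ... | i , j , u→x , x→v , i+j≡k =
    i , suc j , u→x , step x→v adj w∈V , trans (+-suc i j) (cong suc i+j≡k)

  shortestVia-target : Diameter≤2 → (∀ u w → Dec (Adj u w)) →
                       ∀ {u w} → Vert u → Vert w → u ≢ w → ShortestVia G u w w
  shortestVia-target diam adjacent? {u} {w} u∈V w∈V u≢w with adjacent? u w
  ... | yes adj = 1 , step (here u∈V) adj w∈V , distAtLeast-1 u≢w , inj₁ refl
  ... | no ¬adj with diam u∈V w∈V
  ...   | k , k≤2 , p = k , p , (λ k′ q → ≤-trans k≤2 (distAtLeast-2 u≢w ¬adj k′ q)) , onWalk-target p

  shortestVia-middle : ∀ {u v w} → Vert u → Vert v → Vert w → Adj u v → Adj v w →
                       DistAtLeast u w 2 → ShortestVia G u w v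
  shortestVia-middle u∈V v∈V w∈V uv vw far =
    2 , step (step (here u∈V) uv v∈V) vw w∈V , far , inj₂ (inj₁ refl)

  shortestVia-distant : Diameter≤2 → ∀ {u v w} → Vert u → Vert w →
                        DistAtLeast u v 2 → ShortestVia G u w v → v ≡ w
  shortestVia-distant diam u∈V w∈V far (k , p , shortest , v∈p) with walk-splitAt p v∈p
  ... | i , zero  , _   , v→w , _     = walk-length0 v→w
  ... | i , suc j , u→v , _   , i+j≡k with diam u∈V w∈V
  ...   | k′ , k′≤2 , q = contradiction (begin
    2 + suc j ≤⟨ +-monoˡ-≤ (suc j) (far i u→v) ⟩
    i + suc j ≡⟨ i+j≡k ⟩
    k         ≤⟨ shortest k′ q ⟩
    k′        ≤⟨ k′≤2 ⟩
    2         ∎) (m+1+n≰m 2)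
    where open ≤-Reasoning

  strongResolvingSet-meets-distantPair :
    Diameter≤2 → ∀ {W u v} → IsStrongResolvingSet G W → Vert u → Vert v →
    DistAtLeast u v 2 → DistAtLeast v u 2 → u ∈ˡ W ⊎ v ∈ˡ W
  strongResolvingSet-meets-distantPair diam {W} (W⊆V , resolving) u∈V v∈V uv vu
    with resolving _ _ u∈V v∈V (distant⇒≢ u∈V uv)
  ... | w , w∈W , inj₁ via =
    inj₂ (subst (_∈ˡ W) (sym (shortestVia-distant diam u∈V (All.lookup W⊆V w∈W) uv via)) w∈W)
  ... | w , w∈W , inj₂ via =
    inj₁ (subst (_∈ˡ W) (sym (shortestVia-distant diam v∈V (All.lookup W⊆V w∈W) vu via)) w∈W)

module _ {n : ℕ} where
  open Graph (GcBool n)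

  isVertex : ∀ {p : Subset n} {x y} → x ∈ p → y ∉ p → Vert p
  isVertex {p} {y = y} x∈p y∉p =
    ∈⇒≢⊥ x∈p , ⁅ y ⁆ , ∈⇒≢⊥ (x∈⁅x⁆ y) ,
    disjoint⇒∩≡⊥ λ z∈p z∈⁅y⁆ → y∉p (subst (_∈ p) (x∈⁅y⁆⇒x≡y y z∈⁅y⁆) z∈p)

  vertex-member : ∀ {p} → Vert p → Nonempty p
  vertex-member (p≢⊥ , _) = ≢⊥⇒Nonempty p≢⊥

  vertex-nonmember : ∀ {p} → Vert p → ∃ λ y → y ∉ p
  vertex-nonmember (_ , q , q≢⊥ , p∩q≡⊥) with ≢⊥⇒Nonempty q≢⊥
  ... | y , y∈q = y , λ y∈p → ∩≡⊥⇒disjoint p∩q≡⊥ y∈p y∈q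

  ∁-vertex : ∀ {p} → Vert p → Vert (∁ p)
  ∁-vertex p∈V with vertex-member p∈V | vertex-nonmember p∈V
  ... | _ , x∈p | _ , y∉p = isVertex (x∉p⇒x∈∁p y∉p) (x∈p⇒x∉∁p x∈p)

  adjacent : ∀ {p q x} → p ≢ q → x ∈ p → x ∈ q → Adj p q
  adjacent p≢q x∈p x∈q = p≢q , ∈⇒≢⊥ (x∈p∩q⁺ (x∈p , x∈q))

  adjacent? : ∀ p q → Dec (Adj p q)
  adjacent? p q = ¬? (≡-dec Bool._≟_ p q) ×-dec ¬? (≡-dec Bool._≟_ (p ∩ q) ⊥)

  disjoint-distant : ∀ {p q} → Vert p → (∀ {x} → x ∈ p → x ∉ q) → DistAtLeast (GcBool n) p q 2
  disjoint-distant p∈V disjoint with vertex-member p∈V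
  ... | _ , x∈p = distAtLeast-2 (GcBool n) (λ { refl → disjoint x∈p x∈p })
                                           (λ (_ , p∩q≢⊥) → p∩q≢⊥ (disjoint⇒∩≡⊥ disjoint))

  walk-throughCosingleton : 3 ≤ n → ∀ {u w} → Vert u → Vert w → (∀ {x} → x ∈ u → x ∉ w) →
                            Walk (GcBool n) u w 2
  walk-throughCosingleton 3≤n {u} {w} u∈V w∈V disjoint
    with vertex-member u∈V | vertex-member w∈V
  ... | x , x∈u | y , y∈w with third-element 3≤n x y
  ...   | z , z≢x , z≢y =
    step (step (here u∈V) (adjacent u≢c x∈u x∈c) c∈V) (adjacent c≢w y∈c y∈w) w∈V
    where
    c : Subset n
    c = ∁ ⁅ z ⁆
    ∈c : ∀ {t} → t ≢ z → t ∈ c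
    ∈c t≢z = x∉p⇒x∈∁p (x≢y⇒x∉⁅y⁆ t≢z)
    x∈c : x ∈ c
    x∈c = ∈c (z≢x ∘ sym)
    y∈c : y ∈ c
    y∈c = ∈c (z≢y ∘ sym)
    c∈V : Vert c
    c∈V = isVertex x∈c (x∈p⇒x∉∁p (x∈⁅x⁆ z))
    u≢c : u ≢ c
    u≢c u≡c = disjoint (subst (y ∈_) (sym u≡c) y∈c) y∈w
    c≢w : c ≢ w
    c≢w c≡w = disjoint x∈u (subst (x ∈_) c≡w x∈c)

  diameter≤2 : 3 ≤ n → Diameter≤2 (GcBool n)
  diameter≤2 3≤n {u} {w} u∈V w∈V with adjacent? u w | ≡-dec Bool._≟_ u w
  ... | yes adj | _        = 1 , s≤s z≤n , step (here u∈V) adj w∈V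
  ... | no _    | yes refl = 0 , z≤n , here u∈V
  ... | no ¬adj | no u≢w   = 2 , ≤-refl , walk-throughCosingleton 3≤n u∈V w∈V (∩≡⊥⇒disjoint u∩w≡⊥)
    where
    u∩w≡⊥ : u ∩ w ≡ ⊥
    u∩w≡⊥ = decidable-stable (≡-dec Bool._≟_ (u ∩ w) ⊥) (λ u∩w≢⊥ → ¬adj (u≢w , u∩w≢⊥))

tailUpTo∁ : ∀ {m} → Subset (suc m) → Subset m
tailUpTo∁ (outside ∷ p) = p
tailUpTo∁ (inside  ∷ p) = ∁ p

tailUpTo∁-∁ : ∀ {m} (p : Subset (suc m)) → tailUpTo∁ (∁ p) ≡ tailUpTo∁ p
tailUpTo∁-∁ {m} (outside ∷ p) = ¬-involutive p
  where open BooleanAlgebraProperties (∪-∩-booleanAlgebra m) using (¬-involutive)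
tailUpTo∁-∁     (inside  ∷ p) = refl

avoiding0 : ∀ m → List (Subset (suc m))
avoiding0 m = map (outside ∷_) (nonemptySubsets m)

avoiding0-unique : ∀ m → Unique (avoiding0 m)
avoiding0-unique m = Unique.map⁺ ∷-injectiveʳ (nonemptySubsets-unique m)

length-avoiding0 : ∀ m → length (avoiding0 m) ≡ 2 ^ m ∸ 1
length-avoiding0 m =
  trans (length-map (outside ∷_) (nonemptySubsets m)) (cong (_∸ 1) (length-nonemptySubsets m))

module _ {m : ℕ} (3≤n : 3 ≤ suc m) where
  open Graph (GcBool (suc m))

  outside∷-vertex : ∀ {s} → Nonempty s → Vert (outside ∷ s)
  outside∷-vertex (_ , x∈s) = isVertex {y = zero} (there x∈s) λ ()

  tailUpTo∁-∈ : ∀ {W} → IsStrongResolvingSet (GcBool (suc m)) W →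
                ∀ {p} → Vert p → tailUpTo∁ p ∈ˡ map tailUpTo∁ W
  tailUpTo∁-∈ srs {p} p∈V
    with strongResolvingSet-meets-distantPair (GcBool (suc m)) (diameter≤2 3≤n) srs
           p∈V (∁-vertex p∈V) (disjoint-distant p∈V x∈p⇒x∉∁p) (disjoint-distant (∁-vertex p∈V) x∈∁p⇒x∉p)
  ... | inj₁ p∈W  = ∈-map⁺ tailUpTo∁ p∈W
  ... | inj₂ ∁p∈W = subst (_∈ˡ _) (tailUpTo∁-∁ p) (∈-map⁺ tailUpTo∁ ∁p∈W)

  strongResolvingSet-covers : ∀ {W} → IsStrongResolvingSet (GcBool (suc m)) W →
                              ∀ s → s ∈ˡ ⊥ ∷ map tailUpTo∁ W
  -- The empty tail comes from ∅ and the full set, which are not vertices.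
  strongResolvingSet-covers srs s with nonempty? s
  ... | no s-empty     = here (Empty-unique s-empty)
  ... | yes s-nonempty = there (tailUpTo∁-∈ srs (outside∷-vertex s-nonempty))

  sdim-lowerBound : ∀ W → IsStrongResolvingSet (GcBool (suc m)) W → 2 ^ m ∸ 1 ≤ length W
  sdim-lowerBound W srs = ∸-monoˡ-≤ 1 (subst (2 ^ m ≤_) (cong suc (length-map tailUpTo∁ W))
    (complete⇒2^m≤length m (⊥ ∷ map tailUpTo∁ W) (strongResolvingSet-covers srs)))

  ∈-avoiding0 : ∀ {s} → Vert (outside ∷ s) → (outside ∷ s) ∈ˡ avoiding0 m
  ∈-avoiding0 p∈V with vertex-member p∈V
  ... | suc _ , there x∈s = ∈-map⁺ (outside ∷_) (∈-nonemptySubsets x∈s)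

  singleton-resolves : ∀ {p q x} → x ∈ p → x ∉ q → Vert (inside ∷ p) → Vert (inside ∷ q) →
                       ShortestVia (GcBool (suc m)) (inside ∷ q) ⁅ suc x ⁆ (inside ∷ p)
  singleton-resolves {p} {q} {x} x∈p x∉q u∈V v∈V =
    shortestVia-middle (GcBool (suc m)) v∈V u∈V ⁅x⁆∈V
      (adjacent v≢u here here) (adjacent (λ ()) (there x∈p) (x∈⁅x⁆ (suc x)))
      (disjoint-distant v∈V v-disjoint-⁅x⁆)
    where
    ⁅x⁆∈V : Vert ⁅ suc x ⁆
    ⁅x⁆∈V = isVertex {y = zero} (x∈⁅x⁆ (suc x)) λ ()
    v≢u : inside ∷ q ≢ inside ∷ p
    v≢u v≡u = x∉q (subst (x ∈_) (sym (∷-injectiveʳ v≡u)) x∈p)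
    v-disjoint-⁅x⁆ : ∀ {t} → t ∈ inside ∷ q → t ∉ ⁅ suc x ⁆
    v-disjoint-⁅x⁆ t∈v t∈⁅x⁆ = x∉q (drop-there (subst (_∈ inside ∷ q) (x∈⁅y⁆⇒x≡y (suc x) t∈⁅x⁆) t∈v))

  avoiding0-resolving : IsStrongResolvingSet (GcBool (suc m)) (avoiding0 m)
  avoiding0-resolving = All.map⁺ (All.map outside∷-vertex (nonemptySubsets-nonempty m)) , resolve
    where
    target : ∀ {u w} → Vert u → Vert w → u ≢ w → ShortestVia (GcBool (suc m)) u w w
    target = shortestVia-target (GcBool (suc m)) (diameter≤2 3≤n) adjacent?
    ⁅x⁆∈avoiding0 : ∀ x → ⁅ suc x ⁆ ∈ˡ avoiding0 m
    ⁅x⁆∈avoiding0 x = ∈-map⁺ (outside ∷_) (∈-nonemptySubsets (x∈⁅x⁆ x))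
    resolve : ∀ u v → Vert u → Vert v → u ≢ v →
              ∃ λ w → w ∈ˡ avoiding0 m × StronglyResolves (GcBool (suc m)) w u v
    resolve u@(outside ∷ _) v u∈V v∈V u≢v = u , ∈-avoiding0 u∈V , inj₂ (target v∈V u∈V (u≢v ∘ sym))
    resolve (inside ∷ _) v@(outside ∷ _) u∈V v∈V u≢v = v , ∈-avoiding0 v∈V , inj₁ (target u∈V v∈V u≢v)
    resolve (inside ∷ p) (inside ∷ q) u∈V v∈V u≢v
      with ≢⇒distinguished p q (u≢v ∘ cong (inside ∷_))
    ... | x , inj₁ (x∈p , x∉q) = ⁅ suc x ⁆ , ⁅x⁆∈avoiding0 x , inj₂ (singleton-resolves x∈p x∉q u∈V v∈V)
    ... | x , inj₂ (x∈q , x∉p) = ⁅ suc x ⁆ , ⁅x⁆∈avoiding0 x , inj₁ (singleton-resolves x∈q x∉p v∈V u∈V)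

  sdim-GcBool : IsSdim (GcBool (suc m)) (2 ^ m ∸ 1)
  sdim-GcBool = (avoiding0 m , avoiding0-unique m , avoiding0-resolving , length-avoiding0 m) ,
                sdim-lowerBound

2^[1+m]∸2^m≡2^m : ∀ m → 2 ^ suc m ∸ 2 ^ m ≡ 2 ^ m
2^[1+m]∸2^m≡2^m m = trans (m+n∸m≡n (2 ^ m) (2 ^ m + 0)) (+-identityʳ (2 ^ m))

corollary3p21 : (n : ℕ) → 3 ≤ n →
    IsSdim (GcBool n) (2 ^ n ∸ 2 ^ (n ∸ 1) ∸ 1)
corollary3p21 (suc m) 3≤n =
  subst (IsSdim (GcBool (suc m))) (cong (_∸ 1) (sym (2^[1+m]∸2^m≡2^m m))) (sdim-GcBool 3≤n)
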